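{- Define the numbers $a^n_{sj}, b^n_{sj}$ (for $n\ge1$, $1\le j\le n$), $\theta^n$ and $\phi^n$ (for $n\ge 2$) recursively as follows. - Base case: $a^1_{s1}=b^1_{s1}=1$. - For $n\ge 2$: $\theta^n=3a^{n-1}_{s,n-1}$. - $\phi^2=4$, and for $n>2$, $\phi^n=4\sum_{j=1}^{n-1}\left(\theta^n b^{n-1}_{sj}-3a^{n-1}_{sj}\right)$. - For $n\ge2$ and $j<n$: $a^n_{sj}=4a^{n-1}_{sj}$ and $b^n_{sj}=(1+\theta^n)b^{n-1}_{sj}$. - For $n\ge 2$: $a^n_{sn}=\phi^n$ and $b^n_{sn}=1$. Then for every $n\ge 2$ and every $1\le j<n$, $u^n_{nj}:=\theta^n b^{n-1}_{sj}-3a^{n-1}_{sj}\ge 0$.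
   Context: The quantity $u^n_{nj}$ is the capacity of the internal arc $n\to j$ in the network $\mathcal N^n$ constructed in the paper. -}

module Defs where

open import Data.Nat using (ℕ; zero; suc; _≡ᵇ_; _<ᵇ_; _∸_)
open import Data.Integer using (ℤ; +_; _+_; _*_; _-_)
open import Data.Bool using (if_then_else_)
open import Data.Product using (_×_; _,_; proj₁; proj₂)

sumFrom1 : ℕ → (ℕ → ℤ) → ℤ
sumFrom1 zero    f = + 0
sumFrom1 (suc k) f = sumFrom1 k f + f (suc k)

-- step m (a^{n-1}_{s·}, b^{n-1}_{s·}) = (a^n_{s·}, b^n_{s·})  where n = m + 2
step : ℕ → (ℕ → ℤ) × (ℕ → ℤ) → (ℕ → ℤ) × (ℕ → ℤ)
step m (A , B) = A' , B'
  where
  θn : ℤ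
  θn = + 3 * A (suc m)
  φn : ℤ
  φn = if m ≡ᵇ 0 then + 4
       else + 4 * sumFrom1 (suc m) (λ j → θn * B j - + 3 * A j)
  A' : ℕ → ℤ
  A' j = if j ≡ᵇ 0 then + 0
         else if j <ᵇ suc (suc m) then + 4 * A j
         else if j ≡ᵇ suc (suc m) then φn
         else + 0
  B' : ℕ → ℤ
  B' j = if j ≡ᵇ 0 then + 0
         else if j <ᵇ suc (suc m) then (+ 1 + θn) * B j
         else if j ≡ᵇ suc (suc m) then + 1
         else + 0

-- level n = (j ↦ a^n_{sj} , j ↦ b^n_{sj}), meaningful for n ≥ 1 and 1 ≤ j ≤ n
-- (value 0 outside that range; never used by the statement).
level : ℕ → (ℕ → ℤ) × (ℕ → ℤ)
level zero = (λ _ → + 0) , (λ _ → + 0)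
level (suc zero) = (λ j → if j ≡ᵇ 1 then + 1 else + 0)
                 , (λ j → if j ≡ᵇ 1 then + 1 else + 0)
level (suc (suc m)) = step m (level (suc m))

a : ℕ → ℕ → ℤ
a n = proj₁ (level n)

b : ℕ → ℕ → ℤ
b n = proj₂ (level n)

θ : ℕ → ℤ
θ n = + 3 * a (n ∸ 1) (n ∸ 1)

-- φ^n (for n ≥ 2): φ^2 = 4, φ^n = 4 Σ_{j=1}^{n-1} (θ^n b^{n-1}_{sj} - 3 a^{n-1}_{sj})
-- (a^n_{sn} = φ^n by construction of `level`)
φ : ℕ → ℤ
φ n = a n n

u : ℕ → ℕ → ℤ
u n j = θ n * b (n ∸ 1) j - + 3 * a (n ∸ 1) j

{-# OPTIONS --safe #-}
module Submission where

-- Every level n has positive b's and a top entry that dominates the others: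
-- a^n_j ≤ a^n_n b^n_j for j ≤ n, strictly for j < n.  Since θ^{n+1} = 3 a^n_n,
-- this is exactly u^{n+1}_{n+1,j} ≥ 0.  The invariant propagates: the j = 1 term of
-- φ^{n+1} = 4 Σ_j u^{n+1}_{n+1,j} is positive by strictness, so φ^{n+1} ≥ 4, and as
-- 1 + θ^{n+1} > a^n_n we get 4 a^n_j ≤ 4 a^n_n b^n_j < φ^{n+1} (1 + θ^{n+1}) b^n_j.

open import Defs
open import Data.Nat using (ℕ; _≤_; _<_; zero; suc; z≤n; s≤s; _≡ᵇ_; _<ᵇ_)
open import Data.Integer using (+_)
import Data.Integer as ℤ

open import Data.Nat.Properties using (≤-refl; <⇒<ᵇ; ≡⇒≡ᵇ; m≤n⇒m≤1+n; m≤n⇒m<n∨m≡n)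
open import Data.Integer using (ℤ; 0ℤ; 1ℤ; _*_; _-_; -_; +≤+; +<+; positive; nonNegative)
import Data.Integer.Properties as ℤP
open import Data.Bool using (true; false)
open import Data.Bool.Properties using (T-≡)
open import Data.Product using (_,_; proj₁; proj₂)
open import Data.Sum using (inj₁; inj₂)
open import Function using (Equivalence)
open import Relation.Binary.PropositionalEquality using (_≡_; refl; sym; subst)

<ᵇ-true : ∀ {m n} → m < n → (m <ᵇ n) ≡ true
<ᵇ-true m<n = Equivalence.to T-≡ (<⇒<ᵇ m<n)

≡ᵇ-refl : ∀ n → (n ≡ᵇ n) ≡ true
≡ᵇ-refl n = Equivalence.to T-≡ (≡⇒≡ᵇ n n refl)

<ᵇ-irrefl : ∀ n → (n <ᵇ n) ≡ false
<ᵇ-irrefl zero    = refl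
<ᵇ-irrefl (suc n) = <ᵇ-irrefl n

*-monoˡ-≤-0≤ : ∀ c {x y} → 0ℤ ℤ.≤ c → x ℤ.≤ y → c * x ℤ.≤ c * y
*-monoˡ-≤-0≤ c 0≤c = ℤP.*-monoˡ-≤-nonNeg c {{nonNegative 0≤c}}

*-monoʳ-≤-0≤ : ∀ c {x y} → 0ℤ ℤ.≤ c → x ℤ.≤ y → x * c ℤ.≤ y * c
*-monoʳ-≤-0≤ c 0≤c = ℤP.*-monoʳ-≤-nonNeg c {{nonNegative 0≤c}}

*-monoˡ-<-0< : ∀ c {x y} → 0ℤ ℤ.< c → x ℤ.< y → c * x ℤ.< c * y
*-monoˡ-<-0< c 0<c = ℤP.*-monoˡ-<-pos c {{positive 0<c}}

*-monoʳ-<-0< : ∀ c {x y} → 0ℤ ℤ.< c → x ℤ.< y → x * c ℤ.< y * c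
*-monoʳ-<-0< c 0<c = ℤP.*-monoʳ-<-pos c {{positive 0<c}}

*-pos : ∀ {i j} → 0ℤ ℤ.< i → 0ℤ ℤ.< j → 0ℤ ℤ.< i * j
*-pos (+<+ (s≤s _)) (+<+ (s≤s _)) = +<+ (s≤s z≤n)

i<j⇒0<j-i : ∀ {i j} → i ℤ.< j → 0ℤ ℤ.< j - i
i<j⇒0<j-i {i} {j} i<j = subst (ℤ._< j - i) (ℤP.+-inverseʳ i) (ℤP.+-monoˡ-< (- i) i<j)

i<1+3i : ∀ {i} → 0ℤ ℤ.≤ i → i ℤ.< 1ℤ ℤ.+ + 3 * i
i<1+3i {i} 0≤i = ℤP.suc[i]≤j⇒i<j (ℤP.+-monoʳ-≤ 1ℤ
  (subst (ℤ._≤ + 3 * i) (ℤP.*-identityˡ i) (*-monoʳ-≤-0≤ i {1ℤ} {+ 3} 0≤i (+≤+ (s≤s z≤n)))))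

-- u (suc n) j ≡ arcCapacity (a n) (b n) n j
arcCapacity : (A B : ℕ → ℤ) (n j : ℕ) → ℤ
arcCapacity A B n j = + 3 * A n * B j - + 3 * A j

arcCapacity-nonNeg : ∀ A B n j → A j ℤ.≤ A n * B j → 0ℤ ℤ.≤ arcCapacity A B n j
arcCapacity-nonNeg A B n j Aj≤AnBj rewrite ℤP.*-assoc (+ 3) (A n) (B j) =
  ℤP.i≤j⇒0≤j-i (*-monoˡ-≤-0≤ (+ 3) (+≤+ z≤n) Aj≤AnBj)

arcCapacity-pos : ∀ A B n j → A j ℤ.< A n * B j → 0ℤ ℤ.< arcCapacity A B n j
arcCapacity-pos A B n j Aj<AnBj rewrite ℤP.*-assoc (+ 3) (A n) (B j) =
  i<j⇒0<j-i (*-monoˡ-<-0< (+ 3) (+<+ (s≤s z≤n)) Aj<AnBj)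

f1≤sumFrom1 : ∀ k (f : ℕ → ℤ) → (∀ {j} → 1 ≤ j → j ≤ suc k → 0ℤ ℤ.≤ f j) →
              f 1 ℤ.≤ sumFrom1 (suc k) f
f1≤sumFrom1 zero    f _      = ℤP.≤-reflexive (sym (ℤP.+-identityˡ (f 1)))
f1≤sumFrom1 (suc k) f nonNeg = ℤP.≤-trans
  (f1≤sumFrom1 k f (λ 1≤j j≤1+k → nonNeg 1≤j (m≤n⇒m≤1+n j≤1+k)))
  (ℤP.i≤i+j _ _ {{nonNegative (nonNeg (s≤s z≤n) ≤-refl)}})

module _ (A B : ℕ → ℤ) where

  step-a-below : ∀ m {j} → 1 ≤ j → j ≤ suc m → proj₁ (step m (A , B)) j ≡ + 4 * A j
  step-a-below m {suc j} _ j≤1+m rewrite <ᵇ-true j≤1+m = refl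

  step-b-below : ∀ m {j} → 1 ≤ j → j ≤ suc m →
                 proj₂ (step m (A , B)) j ≡ (1ℤ ℤ.+ + 3 * A (suc m)) * B j
  step-b-below m {suc j} _ j≤1+m rewrite <ᵇ-true j≤1+m = refl

  step-a-top : ∀ m → proj₁ (step (suc m) (A , B)) (suc (suc (suc m)))
                     ≡ + 4 * sumFrom1 (suc (suc m)) (arcCapacity A B (suc (suc m)))
  step-a-top m rewrite <ᵇ-irrefl m | ≡ᵇ-refl m = refl

  step-b-top : ∀ m → proj₂ (step m (A , B)) (suc (suc m)) ≡ 1ℤ
  step-b-top m rewrite <ᵇ-irrefl m | ≡ᵇ-refl m = refl

record TopDominates (A B : ℕ → ℤ) (n : ℕ) : Set where
  field
    B-pos   : ∀ {j} → 1 ≤ j → j ≤ n → 0ℤ ℤ.< B j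
    A≤top*B : ∀ {j} → 1 ≤ j → j ≤ n → A j ℤ.≤ A n * B j
    A<top*B : ∀ {j} → 1 ≤ j → j < n → A j ℤ.< A n * B j
    top-pos : 0ℤ ℤ.< A n

open TopDominates

step-top≥4 : ∀ m {A B} → TopDominates A B (suc m) → + 4 ℤ.≤ proj₁ (step m (A , B)) (suc (suc m))
step-top≥4 zero    _          = ℤP.≤-refl
step-top≥4 (suc m) {A} {B} dom rewrite step-a-top A B m =
  *-monoˡ-≤-0≤ (+ 4) (+≤+ z≤n) (ℤP.i<j⇒suc[i]≤j (ℤP.<-≤-trans capacity₁-pos capacity₁≤sum))
  where
  capacity₁-pos : 0ℤ ℤ.< arcCapacity A B (suc (suc m)) 1
  capacity₁-pos = arcCapacity-pos A B (suc (suc m)) 1 (A<top*B dom (s≤s z≤n) (s≤s (s≤s z≤n)))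
  capacity₁≤sum : arcCapacity A B (suc (suc m)) 1
                  ℤ.≤ sumFrom1 (suc (suc m)) (arcCapacity A B (suc (suc m)))
  capacity₁≤sum = f1≤sumFrom1 (suc m) (arcCapacity A B (suc (suc m)))
    (λ {j} 1≤j j≤n → arcCapacity-nonNeg A B (suc (suc m)) j (A≤top*B dom 1≤j j≤n))

step-topDominates : ∀ m {A B} → TopDominates A B (suc m) →
                    TopDominates (proj₁ (step m (A , B))) (proj₂ (step m (A , B))) (suc (suc m))
step-topDominates m {A} {B} dom = record
  { B-pos   = B'-pos
  ; A≤top*B = A'≤top*B'
  ; A<top*B = λ { 1≤j (s≤s j≤1+m) → A'<top*B'-below 1≤j j≤1+m }
  ; top-pos = ℤP.<-≤-trans (+<+ (s≤s z≤n)) top≥4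
  }
  where
  open ℤP.≤-Reasoning
  A' B' : ℕ → ℤ
  A' = proj₁ (step m (A , B))
  B' = proj₂ (step m (A , B))
  c : ℤ
  c = 1ℤ ℤ.+ + 3 * A (suc m)
  top≥4 : + 4 ℤ.≤ A' (suc (suc m))
  top≥4 = step-top≥4 m dom
  A<c : A (suc m) ℤ.< c
  A<c = i<1+3i (ℤP.<⇒≤ (top-pos dom))
  0<c : 0ℤ ℤ.< c
  0<c = ℤP.<-trans (top-pos dom) A<c
  B'-pos-below : ∀ {j} → 1 ≤ j → j ≤ suc m → 0ℤ ℤ.< B' j
  B'-pos-below 1≤j j≤1+m rewrite step-b-below A B m 1≤j j≤1+m = *-pos 0<c (B-pos dom 1≤j j≤1+m)
  A'<top*B'-below : ∀ {j} → 1 ≤ j → j ≤ suc m → A' j ℤ.< A' (suc (suc m)) * B' j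
  A'<top*B'-below {j} 1≤j j≤1+m
    rewrite step-a-below A B m 1≤j j≤1+m | step-b-below A B m 1≤j j≤1+m =
    begin-strict
      + 4 * A j
        ≤⟨ *-monoˡ-≤-0≤ (+ 4) (+≤+ z≤n) (A≤top*B dom 1≤j j≤1+m) ⟩
      + 4 * (A (suc m) * B j)
        <⟨ *-monoˡ-<-0< (+ 4) (+<+ (s≤s z≤n)) (*-monoʳ-<-0< (B j) 0<Bj A<c) ⟩
      + 4 * (c * B j)
        ≤⟨ *-monoʳ-≤-0≤ (c * B j) (ℤP.<⇒≤ (*-pos 0<c 0<Bj)) top≥4 ⟩
      A' (suc (suc m)) * (c * B j) ∎
    where
    0<Bj : 0ℤ ℤ.< B j
    0<Bj = B-pos dom 1≤j j≤1+m
  B'-pos : ∀ {j} → 1 ≤ j → j ≤ suc (suc m) → 0ℤ ℤ.< B' j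
  B'-pos 1≤j j≤2+m with m≤n⇒m<n∨m≡n j≤2+m
  ... | inj₁ (s≤s j≤1+m) = B'-pos-below 1≤j j≤1+m
  ... | inj₂ refl rewrite step-b-top A B m = +<+ (s≤s z≤n)
  A'≤top*B' : ∀ {j} → 1 ≤ j → j ≤ suc (suc m) → A' j ℤ.≤ A' (suc (suc m)) * B' j
  A'≤top*B' 1≤j j≤2+m with m≤n⇒m<n∨m≡n j≤2+m
  ... | inj₁ (s≤s j≤1+m) = ℤP.<⇒≤ (A'<top*B'-below 1≤j j≤1+m)
  ... | inj₂ refl rewrite step-b-top A B m = ℤP.≤-reflexive (sym (ℤP.*-identityʳ _))

level-topDominates : ∀ m → TopDominates (a (suc m)) (b (suc m)) (suc m)
level-topDominates zero = record
  { B-pos   = λ { {suc zero} _ _ → +<+ (s≤s z≤n) ; {suc (suc _)} _ (s≤s ()) }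
  ; A≤top*B = λ { {suc zero} _ _ → ℤP.≤-refl ; {suc (suc _)} _ (s≤s ()) }
  ; A<top*B = λ { {suc _} _ (s≤s ()) }
  ; top-pos = +<+ (s≤s z≤n)
  }
level-topDominates (suc m) = step-topDominates m (level-topDominates m)

lemma2 : (n j : ℕ) → 2 ≤ n → 1 ≤ j → j < n → + 0 ℤ.≤ u n j
lemma2 (suc zero)    _ (s≤s ()) _ _
lemma2 (suc (suc m)) j _ 1≤j (s≤s j≤1+m) =
  arcCapacity-nonNeg (a (suc m)) (b (suc m)) (suc m) j (A≤top*B (level-topDominates m) 1≤j j≤1+m)
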